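{- Let $n\ge1$ and write $n+1=2^{e_0}p_1^{e_1}p_2^{e_2}\cdots p_k^{e_k}$ where $p_1,\dots,p_k$ are distinct odd primes and $e_0,e_1,\dots,e_k\ge0$. Then \[E_n\ge 2^{\lfloor e_0/2\rfloor+e_1+e_2+\cdots+e_k}.\]
   Context: For a binary string $s=s_1\cdots s_n$, its composition multiset $\mathcal S_s$ is the multiset of compositions (numbers of 0's and 1's) of all contiguous substrings $s_i\cdots s_j$, $1\le i\le j\le n$, counted with multiplicity. Strings $s,t$ are equicomposable ($s\sim t$) if $\mathcal S_s=\mathcal S_t$. For $s\in\{0,1\}^n$ let $E_s=\{t: t\sim s\}$, and let $E_n=\max\{|E_s|: s\in\{0,1\}^n\}$. -}

module Defs where

open import Data.Nat using (ℕ; zero; suc; _+_; _*_; _^_)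
open import Data.Bool using (Bool; true; false)
open import Data.Product using (Σ; _×_; _,_; ∃-syntax)
open import Data.List using (List; []; _∷_; map; concatMap; length; filter)
open import Data.Vec using (Vec; toList; []; _∷_)
open import Data.Fin using (Fin)
open import Data.List.Relation.Binary.Permutation.Propositional using (_↭_)
open import Function.Definitions using (Injective)
open import Relation.Binary.PropositionalEquality using (_≡_)

BinString : ℕ → Set
BinString n = Vec Bool n

nePrefixes : List Bool → List (List Bool)
nePrefixes []       = []
nePrefixes (b ∷ bs) = (b ∷ []) ∷ map (b ∷_) (nePrefixes bs)

suffixes : List Bool → List (List Bool)
suffixes []       = [] ∷ []
suffixes (b ∷ bs) = (b ∷ bs) ∷ suffixes bs

-- all contiguous nonempty substrings s_i..s_j, one entry per pair (i , j), i ≤ j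
substrings : List Bool → List (List Bool)
substrings s = concatMap nePrefixes (suffixes s)

countB : Bool → List Bool → ℕ
countB b []        = 0
countB true  (true ∷ xs)  = suc (countB true xs)
countB true  (false ∷ xs) = countB true xs
countB false (false ∷ xs) = suc (countB false xs)
countB false (true ∷ xs)  = countB false xs

-- composition of a string: (number of 0's , number of 1's); 0 = false, 1 = true
composition : List Bool → ℕ × ℕ
composition w = countB false w , countB true w

-- composition multiset S_s, as a list taken up to permutation
compMultiset : ∀ {n} → BinString n → List (ℕ × ℕ)
compMultiset s = map composition (substrings (toList s))

_∼_ : ∀ {n} → BinString n → BinString n → Set
s ∼ t = compMultiset s ↭ compMultiset t

-- |E_s| ≥ N : there are N pairwise distinct strings t with t ∼ s
CardEqClassAtLeast : ∀ {n} → BinString n → ℕ → Set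
CardEqClassAtLeast {n} s N =
  Σ (Fin N → BinString n) (λ f → Injective _≡_ _≡_ f × (∀ (i : Fin N) → f i ∼ s))

-- E_n ≥ N : some s ∈ {0,1}^n has |E_s| ≥ N  (E_n is the maximum of |E_s|)
MaxEqClassAtLeast : ℕ → ℕ → Set
MaxEqClassAtLeast n N = Σ (BinString n) (λ s → CardEqClassAtLeast s N)

primePowProd : ∀ {k} → Vec ℕ k → Vec ℕ k → ℕ
primePowProd []       []       = 1
primePowProd (p ∷ ps) (e ∷ es) = p ^ e * primePowProd ps es

-- Read a binary string as a lattice path from the origin, 0 being the step (1,0) and 1 the step
-- (0,1). The composition of s_i⋯s_j is the difference of the j-th and (i−1)-th vertices of the path,
-- and since the weight x + y of the vertices increases strictly, the composition multiset is the
-- positive part of the multiset of all differences of vertices. So s ∼ t follows from s ≋ t: the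
-- vertex sets have the same difference multiset and the paths the same endpoint.
-- For u = u₁⋯u_k put u ⊛ v = v u₁ v u₂ ⋯ v u_k v. Its vertex set is the Minkowski sum of the vertex
-- set of v and of the path of u with every step shifted by the endpoint of v, so v ≋ v' gives
-- u ⊛ v ≋ u ⊛ v'. Reversing a path reflects its vertex set, so w ≋ reverse w, and since
-- reverse (u ⊛ v) = reverse u ⊛ reverse v, also u ⊛ v ≋ reverse u ⊛ v. Hence for non-palindromes
-- w₁, …, w_m the 2^m strings w₁^± ⊛ (w₂^± ⊛ ⋯ (w_m^± ⊛ b)) are distinct and equicomposable; their
-- length is (|w₁|+1)⋯(|w_m|+1)(|b|+1) − 1. Take w = 0^{q−2}1 for every odd prime factor q of n + 1
-- (with multiplicity) and for every factor 4 of 2^{e₀}, and b = 0^{e₀ mod 2}.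

module Submission where

open import Defs
open import Data.Nat using (ℕ; suc; _+_; _*_; _^_; _/_; _≥_)
open import Data.Nat.Primality using (Prime)
open import Data.Nat.Divisibility using (_∣_)
open import Data.Fin using (Fin)
open import Data.Vec using (Vec; lookup; sum)
open import Relation.Binary.PropositionalEquality using (_≡_)
open import Relation.Nullary using (¬_)
open import Function.Definitions using (Injective)

open import Data.Bool using (Bool; true; false)
open import Data.Fin using (zero; suc; funToFin; finToFun; combine)
open import Data.Fin.Properties using (funToFin-finToFin)
open import Data.Integer as ℤ using (ℤ; 0ℤ; 1ℤ)
import Data.Integer.Properties as ℤ
open import Data.Integer.Tactic.RingSolver using (solve-∀)
open import Data.List using (List; []; _∷_; [_]; _++_; _∷ʳ_; map; concatMap; filter; length; reverse; replicate)
import Data.List.Properties as List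
open import Data.List.Relation.Binary.Permutation.Propositional
  using (_↭_; prep; swap; ↭-refl; ↭-sym; ↭-trans; ↭-reflexive; module PermutationReasoning)
import Data.List.Relation.Binary.Permutation.Propositional.Properties as ↭
open import Data.List.Relation.Unary.All as All using (All; []; _∷_)
open import Data.List.Relation.Unary.All.Properties using (++⁺; map⁺; replicate⁺)
open import Data.List.Relation.Unary.AllPairs using (AllPairs; []; _∷_)
open import Data.Nat using (zero; _∸_; _≤_; _<_; z≤n; s≤s; _%_)
import Data.Nat.Properties as ℕ
open import Data.Nat.DivMod using (m≡m%n+[m/n]*n; m%n<n)
open import Data.Nat.Divisibility using (∣-refl)
open import Data.Nat.ListAction using (product)
open import Data.Nat.ListAction.Properties using (product-++)
open import Data.Nat.Primality using (¬prime[0]; ¬prime[1])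
import Data.Nat.Tactic.RingSolver as ℕ-Solver
open import Data.Product using (_×_; _,_; proj₁; proj₂)
open import Data.Vec using ([]; _∷_; toList; fromList)
open import Data.Vec.Properties using (toList∘fromList)
open import Function using (_∘_)
open import Relation.Binary.PropositionalEquality
  using (_≗_; refl; sym; trans; cong; cong₂; subst; module ≡-Reasoning)
open import Relation.Nullary using (contradiction)
open import Relation.Unary using (Decidable)

private variable
  A B C : Set

concatMap-↭ : (f : A → List B) {xs ys : List A} → xs ↭ ys → concatMap f xs ↭ concatMap f ys
concatMap-↭ f _↭_.refl         = ↭-refl
concatMap-↭ f (prep x p)        = ↭.++⁺ˡ (f x) (concatMap-↭ f p)
concatMap-↭ f (swap x y p)      = ↭-trans (↭.shifts (f x) (f y)) (↭.++⁺ˡ (f y) (↭.++⁺ˡ (f x) (concatMap-↭ f p)))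
concatMap-↭ f (_↭_.trans p q)   = ↭-trans (concatMap-↭ f p) (concatMap-↭ f q)

concatMap-cong-↭ : {f g : A → List B} → (∀ x → f x ↭ g x) → ∀ xs → concatMap f xs ↭ concatMap g xs
concatMap-cong-↭ f↭g []       = ↭-refl
concatMap-cong-↭ f↭g (x ∷ xs) = ↭.++⁺ (f↭g x) (concatMap-cong-↭ f↭g xs)

concatMap-++-↭ : (f g : A → List B) → ∀ xs →
  concatMap (λ x → f x ++ g x) xs ↭ concatMap f xs ++ concatMap g xs
concatMap-++-↭ f g []       = ↭-refl
concatMap-++-↭ f g (x ∷ xs) = begin
  (f x ++ g x) ++ concatMap (λ x → f x ++ g x) xs   ≡⟨ List.++-assoc (f x) (g x) _ ⟩
  f x ++ g x ++ concatMap (λ x → f x ++ g x) xs     ↭⟨ ↭.++⁺ˡ (f x) (↭.++⁺ˡ (g x) (concatMap-++-↭ f g xs)) ⟩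
  f x ++ g x ++ concatMap f xs ++ concatMap g xs    ↭⟨ ↭.++⁺ˡ (f x) (↭.shifts (g x) (concatMap f xs)) ⟩
  f x ++ concatMap f xs ++ g x ++ concatMap g xs    ≡⟨ List.++-assoc (f x) (concatMap f xs) _ ⟨
  (f x ++ concatMap f xs) ++ g x ++ concatMap g xs  ∎
  where open PermutationReasoning

concatMap-comm : (g : A → B → List C) → ∀ xs ys →
  concatMap (λ x → concatMap (g x) ys) xs ↭ concatMap (λ y → concatMap (λ x → g x y) xs) ys
concatMap-comm g []       ys = ↭-reflexive (sym (concatMap-[] ys))
  where
  concatMap-[] : ∀ ys → concatMap (λ (_ : B) → [] {A = C}) ys ≡ []
  concatMap-[] []       = refl
  concatMap-[] (_ ∷ ys) = concatMap-[] ys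
concatMap-comm g (x ∷ xs) ys = begin
  concatMap (g x) ys ++ concatMap (λ x → concatMap (g x) ys) xs
    ↭⟨ ↭.++⁺ˡ (concatMap (g x) ys) (concatMap-comm g xs ys) ⟩
  concatMap (g x) ys ++ concatMap (λ y → concatMap (λ x → g x y) xs) ys
    ↭⟨ concatMap-++-↭ (g x) (λ y → concatMap (λ x → g x y) xs) ys ⟨
  concatMap (λ y → g x y ++ concatMap (λ x → g x y) xs) ys  ∎
  where open PermutationReasoning

concatMap-concatMap : (f : B → List C) (g : A → List B) → ∀ xs →
  concatMap f (concatMap g xs) ≡ concatMap (λ x → concatMap f (g x)) xs
concatMap-concatMap f g []       = refl
concatMap-concatMap f g (x ∷ xs) =
  trans (List.concatMap-++ f (g x) (concatMap g xs)) (cong (concatMap f (g x) ++_) (concatMap-concatMap f g xs))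

concatMap-singleton : (f : A → B) → ∀ xs → concatMap (λ x → [ f x ]) xs ≡ map f xs
concatMap-singleton f xs = trans (sym (List.concatMap-map [_] f xs)) (List.concatMap-pure (map f xs))

++-injective : ∀ (xs xs' : List A) {ys ys'} → length xs ≡ length xs' → xs ++ ys ≡ xs' ++ ys' → xs ≡ xs' × ys ≡ ys'
++-injective []       []         _   e = refl , e
++-injective (x ∷ xs) (x' ∷ xs') |x| e
  with x≡x' , e' ← List.∷-injective e
  with xs≡xs' , ys≡ys' ← ++-injective xs xs' (ℕ.suc-injective |x|) e'
  = cong₂ _∷_ x≡x' xs≡xs' , ys≡ys'

fromList≡ : ∀ {n} (xs : List A) → length xs ≡ n → Vec A n
fromList≡ xs refl = fromList xs

toList-fromList≡ : ∀ {n} (xs : List A) (|xs| : length xs ≡ n) → toList (fromList≡ xs |xs|) ≡ xs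
toList-fromList≡ xs refl = toList∘fromList xs

funToFin-cong : ∀ {m n} {f g : Fin m → Fin n} → f ≗ g → funToFin f ≡ funToFin g
funToFin-cong {zero}  f≗g = refl
funToFin-cong {suc m} f≗g = cong₂ combine (f≗g zero) (funToFin-cong (f≗g ∘ suc))

finToFun-injective : ∀ {m n} {k k' : Fin (m ^ n)} → finToFun {m} {n} k ≗ finToFun k' → k ≡ k'
finToFun-injective {m} {n} {k} {k'} k≗k' =
  trans (sym (funToFin-finToFin {n} {m} k)) (trans (funToFin-cong k≗k') (funToFin-finToFin {n} {m} k'))

-- Lattice paths

Point : Set
Point = ℤ × ℤ

infixl 6 _⊕_ _⊖_

_⊕_ : Point → Point → Point
(a , b) ⊕ (c , d) = (a ℤ.+ c , b ℤ.+ d)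

_⊖_ : Point → Point → Point
(a , b) ⊖ (c , d) = (a ℤ.- c , b ℤ.- d)

origin : Point
origin = (0ℤ , 0ℤ)

⊕-assoc : ∀ p q r → (p ⊕ q) ⊕ r ≡ p ⊕ (q ⊕ r)
⊕-assoc (a , b) (c , d) (e , f) = cong₂ _,_ (ℤ.+-assoc a c e) (ℤ.+-assoc b d f)

⊕-comm : ∀ p q → p ⊕ q ≡ q ⊕ p
⊕-comm (a , b) (c , d) = cong₂ _,_ (ℤ.+-comm a c) (ℤ.+-comm b d)

⊕-identityˡ : ∀ p → origin ⊕ p ≡ p
⊕-identityˡ (a , b) = cong₂ _,_ (ℤ.+-identityˡ a) (ℤ.+-identityˡ b)

⊕-identityʳ : ∀ p → p ⊕ origin ≡ p
⊕-identityʳ (a , b) = cong₂ _,_ (ℤ.+-identityʳ a) (ℤ.+-identityʳ b)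

⊖-identityʳ : ∀ p → p ⊖ origin ≡ p
⊖-identityʳ (a , b) = cong₂ _,_ (ℤ.+-identityʳ a) (ℤ.+-identityʳ b)

⊕-⊖-cancelˡ : ∀ p q r → (p ⊕ q) ⊖ (p ⊕ r) ≡ q ⊖ r
⊕-⊖-cancelˡ (a , b) (c , d) (e , f) = cong₂ _,_ (lemma a c e) (lemma b d f)
  where
  lemma : ∀ x y z → (x ℤ.+ y) ℤ.- (x ℤ.+ z) ≡ y ℤ.- z
  lemma = solve-∀

⊖-⊖-cancelˡ : ∀ t p q → (t ⊖ p) ⊖ (t ⊖ q) ≡ q ⊖ p
⊖-⊖-cancelˡ (a , b) (c , d) (e , f) = cong₂ _,_ (lemma a c e) (lemma b d f)
  where
  lemma : ∀ x y z → (x ℤ.- y) ℤ.- (x ℤ.- z) ≡ z ℤ.- y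
  lemma = solve-∀

⊕-⊖-interchange : ∀ p q r s → (p ⊕ q) ⊖ (r ⊕ s) ≡ (p ⊖ r) ⊕ (q ⊖ s)
⊕-⊖-interchange (a , b) (c , d) (e , f) (g , h) = cong₂ _,_ (lemma a c e g) (lemma b d f h)
  where
  lemma : ∀ x y z w → (x ℤ.+ y) ℤ.- (z ℤ.+ w) ≡ (x ℤ.- z) ℤ.+ (y ℤ.- w)
  lemma = solve-∀

step : Bool → Point
step false = (1ℤ , 0ℤ)
step true  = (0ℤ , 1ℤ)

displacement : List Bool → Point
displacement []      = origin
displacement (b ∷ w) = step b ⊕ displacement w

path : (Bool → Point) → Point → List Bool → List Point
path δ p []      = [ p ]
path δ p (b ∷ w) = p ∷ path δ (p ⊕ δ b) w

vertices : List Bool → List Point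
vertices = path step origin

displacement-++ : ∀ v w → displacement (v ++ w) ≡ displacement v ⊕ displacement w
displacement-++ []      w = sym (⊕-identityˡ (displacement w))
displacement-++ (b ∷ v) w = trans (cong (step b ⊕_) (displacement-++ v w)) (sym (⊕-assoc (step b) _ _))

path-translate : ∀ δ r p w → path δ (r ⊕ p) w ≡ map (r ⊕_) (path δ p w)
path-translate δ r p []      = refl
path-translate δ r p (b ∷ w) =
  cong (r ⊕ p ∷_) (trans (cong (λ q → path δ q w) (⊕-assoc r p (δ b))) (path-translate δ r (p ⊕ δ b) w))

path-from : ∀ δ p w → path δ p w ≡ map (p ⊕_) (path δ origin w)
path-from δ p w = trans (cong (λ q → path δ q w) (sym (⊕-identityʳ p))) (path-translate δ p origin w)

path-step-++ : ∀ p v c w → path step p (v ++ c ∷ w) ≡ path step p v ++ path step (p ⊕ (displacement v ⊕ step c)) w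
path-step-++ p []      c w = cong (λ q → p ∷ path step (p ⊕ q) w) (sym (⊕-identityˡ (step c)))
path-step-++ p (b ∷ v) c w = cong (p ∷_) (trans (path-step-++ (p ⊕ step b) v c w)
  (cong (λ q → path step (p ⊕ step b) v ++ path step q w)
    (trans (⊕-assoc p (step b) _) (cong (p ⊕_) (sym (⊕-assoc (step b) (displacement v) (step c)))))))

-- Difference multisets

differences : List Point → List Point
differences X = concatMap (λ p → map (p ⊖_) X) X

infixl 6 _⊞_

_⊞_ : List Point → List Point → List Point
X ⊞ Y = concatMap (λ p → map (p ⊕_) Y) X

⊞-congʳ : ∀ X {Y Y'} → Y ↭ Y' → X ⊞ Y ↭ X ⊞ Y'
⊞-congʳ X Y↭Y' = concatMap-cong-↭ (λ p → ↭.map⁺ (p ⊕_) Y↭Y') X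

differences-↭ : ∀ {X Y} → X ↭ Y → differences X ↭ differences Y
differences-↭ {X} {Y} X↭Y =
  ↭-trans (concatMap-cong-↭ (λ p → ↭.map⁺ (p ⊖_) X↭Y) X) (concatMap-↭ (λ p → map (p ⊖_) Y) X↭Y)

differences-⊞ : ∀ X Y → differences (X ⊞ Y) ↭ differences X ⊞ differences Y
differences-⊞ X Y =
  ↭-trans (↭-reflexive expand-left)
  (↭-trans (concatMap-cong-↭ (λ x → concatMap-comm (λ y x' → term x x' y) Y X) X)
  (↭-reflexive (sym expand-right)))
  where
  open ≡-Reasoning
  term : Point → Point → Point → List Point
  term x x' y = map (λ y' → (x ⊖ x') ⊕ (y ⊖ y')) Y
  expand-left : differences (X ⊞ Y) ≡ concatMap (λ x → concatMap (λ y → concatMap (λ x' → term x x' y) X) Y) X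
  expand-left = begin
    concatMap (λ p → map (p ⊖_) (X ⊞ Y)) (X ⊞ Y)
      ≡⟨ concatMap-concatMap (λ p → map (p ⊖_) (X ⊞ Y)) (λ x → map (x ⊕_) Y) X ⟩
    concatMap (λ x → concatMap (λ p → map (p ⊖_) (X ⊞ Y)) (map (x ⊕_) Y)) X
      ≡⟨ List.concatMap-cong (λ x → List.concatMap-map _ (x ⊕_) Y) X ⟩
    concatMap (λ x → concatMap (λ y → map ((x ⊕ y) ⊖_) (X ⊞ Y)) Y) X
      ≡⟨ List.concatMap-cong (λ x → List.concatMap-cong (λ y → map-⊖-⊞ x y) Y) X ⟩
    concatMap (λ x → concatMap (λ y → concatMap (λ x' → term x x' y) X) Y) X ∎
    where
    map-⊖-⊞ : ∀ x y → map ((x ⊕ y) ⊖_) (X ⊞ Y) ≡ concatMap (λ x' → term x x' y) X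
    map-⊖-⊞ x y = trans (List.map-concatMap ((x ⊕ y) ⊖_) (λ x' → map (x' ⊕_) Y) X)
      (List.concatMap-cong (λ x' → trans (sym (List.map-∘ Y)) (List.map-cong (⊕-⊖-interchange x y x') Y)) X)
  expand-right : differences X ⊞ differences Y ≡ concatMap (λ x → concatMap (λ x' → concatMap (term x x') Y) X) X
  expand-right = trans (concatMap-concatMap (λ d → map (d ⊕_) (differences Y)) (λ x → map (x ⊖_) X) X)
    (List.concatMap-cong (λ x → trans (List.concatMap-map _ (x ⊖_) X)
      (List.concatMap-cong (λ x' → trans (List.map-concatMap ((x ⊖ x') ⊕_) (λ y → map (y ⊖_) Y) Y)
        (List.concatMap-cong (λ y → sym (List.map-∘ Y)) Y)) X)) X)

differences-reflect : ∀ t X → differences (map (t ⊖_) X) ↭ differences X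
differences-reflect t X = begin
  differences (map (t ⊖_) X)                           ≡⟨ List.concatMap-map _ (t ⊖_) X ⟩
  concatMap (λ x → map ((t ⊖ x) ⊖_) (map (t ⊖_) X)) X  ≡⟨ List.concatMap-cong reflected-row X ⟩
  concatMap (λ x → concatMap (λ y → [ y ⊖ x ]) X) X    ↭⟨ concatMap-comm (λ x y → [ y ⊖ x ]) X X ⟩
  concatMap (λ y → concatMap (λ x → [ y ⊖ x ]) X) X    ≡⟨ List.concatMap-cong (λ y → concatMap-singleton (y ⊖_) X) X ⟩
  differences X                                        ∎
  where
  open PermutationReasoning
  reflected-row : ∀ x → map ((t ⊖ x) ⊖_) (map (t ⊖_) X) ≡ concatMap (λ y → [ y ⊖ x ]) X
  reflected-row x = trans (sym (List.map-∘ X))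
    (trans (List.map-cong (⊖-⊖-cancelˡ t x) X) (sym (concatMap-singleton (_⊖ x) X)))

infix 4 _≋_

record _≋_ (u v : List Bool) : Set where
  field
    differences↭  : differences (vertices u) ↭ differences (vertices v)
    displacement≡ : displacement u ≡ displacement v

open _≋_

≋-refl : ∀ {u} → u ≋ u
≋-refl = record { differences↭ = ↭-refl ; displacement≡ = refl }

≋-reflexive : ∀ {u v} → u ≡ v → u ≋ v
≋-reflexive refl = ≋-refl

≋-sym : ∀ {u v} → u ≋ v → v ≋ u
≋-sym u≋v = record { differences↭ = ↭-sym (differences↭ u≋v) ; displacement≡ = sym (displacement≡ u≋v) }

≋-trans : ∀ {u v w} → u ≋ v → v ≋ w → u ≋ w
≋-trans u≋v v≋w = record
  { differences↭  = ↭-trans (differences↭ u≋v) (differences↭ v≋w)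
  ; displacement≡ = trans (displacement≡ u≋v) (displacement≡ v≋w)
  }

infixr 5 _⊛_

_⊛_ : List Bool → List Bool → List Bool
[]      ⊛ v = v
(c ∷ u) ⊛ v = v ++ c ∷ (u ⊛ v)

vertices-⊛ : ∀ u v → vertices (u ⊛ v) ≡ path (λ c → displacement v ⊕ step c) origin u ⊞ vertices v
vertices-⊛ u v = trans (from origin u) (List.concatMap-cong (λ p → path-from step p v) (path δ origin u))
  where
  δ : Bool → Point
  δ c = displacement v ⊕ step c
  from : ∀ p u → path step p (u ⊛ v) ≡ concatMap (λ q → path step q v) (path δ p u)
  from p []      = sym (List.++-identityʳ (path step p v))
  from p (c ∷ u) = trans (path-step-++ p v c (u ⊛ v)) (cong (path step p v ++_) (from (p ⊕ δ c) u))

≋-⊛ʳ : ∀ u {v v'} → v ≋ v' → u ⊛ v ≋ u ⊛ v'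
≋-⊛ʳ u {v} {v'} v≋v' = record { differences↭ = ⊛-differences ; displacement≡ = ⊛-displacement u }
  where
  S S' : List Point
  S  = path (λ c → displacement v ⊕ step c) origin u
  S' = path (λ c → displacement v' ⊕ step c) origin u
  S≡S' : S ≡ S'
  S≡S' = cong (λ d → path (λ c → d ⊕ step c) origin u) (displacement≡ v≋v')
  ⊛-differences : differences (vertices (u ⊛ v)) ↭ differences (vertices (u ⊛ v'))
  ⊛-differences = begin
    differences (vertices (u ⊛ v))        ≡⟨ cong differences (vertices-⊛ u v) ⟩
    differences (S ⊞ vertices v)           ↭⟨ differences-⊞ S (vertices v) ⟩
    differences S ⊞ differences (vertices v)  ↭⟨ ⊞-congʳ (differences S) (differences↭ v≋v') ⟩
    differences S ⊞ differences (vertices v')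
      ≡⟨ cong (λ X → differences X ⊞ differences (vertices v')) S≡S' ⟩
    differences S' ⊞ differences (vertices v') ↭⟨ differences-⊞ S' (vertices v') ⟨
    differences (S' ⊞ vertices v')          ≡⟨ cong differences (vertices-⊛ u v') ⟨
    differences (vertices (u ⊛ v'))        ∎
    where open PermutationReasoning
  ⊛-displacement : ∀ u → displacement (u ⊛ v) ≡ displacement (u ⊛ v')
  ⊛-displacement []      = displacement≡ v≋v'
  ⊛-displacement (c ∷ u) = begin
    displacement (v ++ c ∷ u ⊛ v)                       ≡⟨ displacement-++ v (c ∷ u ⊛ v) ⟩
    displacement v ⊕ (step c ⊕ displacement (u ⊛ v))
      ≡⟨ cong₂ (λ d e → d ⊕ (step c ⊕ e)) (displacement≡ v≋v') (⊛-displacement u) ⟩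
    displacement v' ⊕ (step c ⊕ displacement (u ⊛ v'))  ≡⟨ displacement-++ v' (c ∷ u ⊛ v') ⟨
    displacement (v' ++ c ∷ u ⊛ v')                     ∎
    where open ≡-Reasoning

displacement-reverse : ∀ w → displacement (reverse w) ≡ displacement w
displacement-reverse []      = refl
displacement-reverse (b ∷ w) = begin
  displacement (reverse (b ∷ w))            ≡⟨ cong displacement (List.unfold-reverse b w) ⟩
  displacement (reverse w ∷ʳ b)             ≡⟨ displacement-++ (reverse w) [ b ] ⟩
  displacement (reverse w) ⊕ (step b ⊕ origin) ≡⟨ cong₂ _⊕_ (displacement-reverse w) (⊕-identityʳ (step b)) ⟩
  displacement w ⊕ step b                   ≡⟨ ⊕-comm (displacement w) (step b) ⟩
  step b ⊕ displacement w                   ∎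
  where open ≡-Reasoning

vertices-reverse : ∀ w → vertices (reverse w) ≡ reverse (map (displacement w ⊖_) (vertices w))
vertices-reverse []      = refl
vertices-reverse (b ∷ w) = begin
  vertices (reverse (b ∷ w))                  ≡⟨ cong vertices (List.unfold-reverse b w) ⟩
  vertices (reverse w ++ b ∷ [])              ≡⟨ path-step-++ origin (reverse w) b [] ⟩
  vertices (reverse w) ∷ʳ (origin ⊕ (displacement (reverse w) ⊕ step b))
    ≡⟨ cong₂ _∷ʳ_ (vertices-reverse w) last-vertex ⟩
  reverse (map (displacement w ⊖_) (vertices w)) ∷ʳ t  ≡⟨ cong (λ xs → reverse xs ∷ʳ t) reflected-tail ⟨
  reverse (map (t ⊖_) tail) ∷ʳ t              ≡⟨ cong (reverse (map (t ⊖_) tail) ∷ʳ_) (⊖-identityʳ t) ⟨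
  reverse (map (t ⊖_) tail) ∷ʳ (t ⊖ origin)   ≡⟨ List.unfold-reverse (t ⊖ origin) (map (t ⊖_) tail) ⟨
  reverse (map (t ⊖_) (vertices (b ∷ w)))     ∎
  where
  open ≡-Reasoning
  t : Point
  t = step b ⊕ displacement w
  tail : List Point
  tail = path step (origin ⊕ step b) w
  last-vertex : origin ⊕ (displacement (reverse w) ⊕ step b) ≡ t
  last-vertex = trans (⊕-identityˡ _) (trans (cong (_⊕ step b) (displacement-reverse w)) (⊕-comm (displacement w) (step b)))
  reflected-tail : map (t ⊖_) tail ≡ map (displacement w ⊖_) (vertices w)
  reflected-tail = begin
    map (t ⊖_) tail                              ≡⟨ cong (λ p → map (t ⊖_) (path step p w)) (⊕-identityˡ (step b)) ⟩
    map (t ⊖_) (path step (step b) w)            ≡⟨ cong (map (t ⊖_)) (path-from step (step b) w) ⟩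
    map (t ⊖_) (map (step b ⊕_) (vertices w))    ≡⟨ List.map-∘ (vertices w) ⟨
    map (λ p → t ⊖ (step b ⊕ p)) (vertices w)   ≡⟨ List.map-cong (⊕-⊖-cancelˡ (step b) (displacement w)) (vertices w) ⟩
    map (displacement w ⊖_) (vertices w)         ∎

≋-reverse : ∀ w → w ≋ reverse w
≋-reverse w = record
  { differences↭  = ↭-sym (begin
      differences (vertices (reverse w))                ≡⟨ cong differences (vertices-reverse w) ⟩
      differences (reverse reflected)                   ↭⟨ differences-↭ (↭.↭-reverse reflected) ⟩
      differences reflected                             ↭⟨ differences-reflect (displacement w) (vertices w) ⟩
      differences (vertices w)                          ∎)
  ; displacement≡ = sym (displacement-reverse w)
  }
  where
  open PermutationReasoning
  reflected : List Point
  reflected = map (displacement w ⊖_) (vertices w)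

reverse-⊛ : ∀ u v → reverse (u ⊛ v) ≡ reverse u ⊛ reverse v
reverse-⊛ [] v = refl
reverse-⊛ (c ∷ u) v = begin
  reverse (v ++ c ∷ u ⊛ v)                      ≡⟨ List.reverse-++ v (c ∷ u ⊛ v) ⟩
  reverse (c ∷ u ⊛ v) ++ reverse v              ≡⟨ cong (_++ reverse v) (List.unfold-reverse c (u ⊛ v)) ⟩
  (reverse (u ⊛ v) ∷ʳ c) ++ reverse v           ≡⟨ List.++-assoc (reverse (u ⊛ v)) [ c ] (reverse v) ⟩
  reverse (u ⊛ v) ++ c ∷ reverse v              ≡⟨ cong (_++ c ∷ reverse v) (reverse-⊛ u v) ⟩
  (reverse u ⊛ reverse v) ++ c ∷ reverse v      ≡⟨ ∷ʳ-⊛ (reverse u) c (reverse v) ⟨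
  (reverse u ∷ʳ c) ⊛ reverse v                  ≡⟨ cong (_⊛ reverse v) (List.unfold-reverse c u) ⟨
  reverse (c ∷ u) ⊛ reverse v                   ∎
  where
  open ≡-Reasoning
  ∷ʳ-⊛ : ∀ u c v → (u ∷ʳ c) ⊛ v ≡ (u ⊛ v) ++ c ∷ v
  ∷ʳ-⊛ []      c v = refl
  ∷ʳ-⊛ (d ∷ u) c v = trans (cong (λ x → v ++ d ∷ x) (∷ʳ-⊛ u c v)) (sym (List.++-assoc v (d ∷ u ⊛ v) (c ∷ v)))

≋-⊛-reverseˡ : ∀ u v → u ⊛ v ≋ reverse u ⊛ v
≋-⊛-reverseˡ u v =
  ≋-trans (≋-reverse (u ⊛ v)) (≋-trans (≋-reflexive (reverse-⊛ u v)) (≋-⊛ʳ (reverse u) (≋-sym (≋-reverse v))))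

-- Compositions as positive differences

weight : Point → ℤ
weight (x , y) = x ℤ.+ y

infix 4 _<ʷ_

_<ʷ_ : Point → Point → Set
p <ʷ q = weight p ℤ.< weight q

Positive : Point → Set
Positive d = origin <ʷ d

positive? : Decidable Positive
positive? d = 0ℤ ℤ.<? weight d

weight-⊖ : ∀ p q → weight (p ⊖ q) ≡ weight p ℤ.- weight q
weight-⊖ (a , b) (c , d) = lemma a b c d
  where
  lemma : ∀ a b c d → (a ℤ.- c) ℤ.+ (b ℤ.- d) ≡ (a ℤ.+ b) ℤ.- (c ℤ.+ d)
  lemma = solve-∀

weight-⊕-step : ∀ p b → weight (p ⊕ step b) ≡ ℤ.suc (weight p)
weight-⊕-step (x , y) false = lemma x y
  where
  lemma : ∀ x y → (x ℤ.+ 1ℤ) ℤ.+ (y ℤ.+ 0ℤ) ≡ 1ℤ ℤ.+ (x ℤ.+ y)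
  lemma = solve-∀
weight-⊕-step (x , y) true = lemma x y
  where
  lemma : ∀ x y → (x ℤ.+ 0ℤ) ℤ.+ (y ℤ.+ 1ℤ) ≡ 1ℤ ℤ.+ (x ℤ.+ y)
  lemma = solve-∀

<ʷ⇒positive : ∀ {p q} → p <ʷ q → Positive (q ⊖ p)
<ʷ⇒positive {p} {q} p<q = subst (0ℤ ℤ.<_) (sym (weight-⊖ q p))
  (subst (ℤ._< weight q ℤ.- weight p) (ℤ.+-inverseʳ (weight p)) (ℤ.+-monoˡ-< (ℤ.- weight p) p<q))

<ʷ⇒¬positive : ∀ {p q} → p <ʷ q → ¬ Positive (p ⊖ q)
<ʷ⇒¬positive {p} {q} p<q = ℤ.≤⇒≯ (subst (ℤ._≤ 0ℤ) (sym (weight-⊖ p q)) (ℤ.i≤j⇒i-j≤0 (ℤ.<⇒≤ p<q)))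

¬positive-⊖-self : ∀ p → ¬ Positive (p ⊖ p)
¬positive-⊖-self p = ℤ.<-irrefl (sym (trans (weight-⊖ p p) (ℤ.+-inverseʳ (weight p))))

forwardDifferences : List Point → List Point
forwardDifferences []      = []
forwardDifferences (p ∷ X) = map (_⊖ p) X ++ forwardDifferences X

filter-positive-differences : ∀ {X} → AllPairs _<ʷ_ X → filter positive? (differences X) ↭ forwardDifferences X
filter-positive-differences {[]}    []              = ↭-refl
filter-positive-differences {p ∷ X} (p<X ∷ X-incr) = begin
  filter positive? ((p ⊖ p ∷ map (p ⊖_) X) ++ later-rows)
    ≡⟨ List.filter-++ positive? (p ⊖ p ∷ map (p ⊖_) X) later-rows ⟩
  filter positive? (p ⊖ p ∷ map (p ⊖_) X) ++ filter positive? later-rows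
    ≡⟨ cong (_++ filter positive? later-rows) (List.filter-none positive? backward) ⟩
  filter positive? later-rows
    ↭⟨ ↭.filter-↭ positive? later-rows-split ⟩
  filter positive? (map (_⊖ p) X ++ differences X)
    ≡⟨ List.filter-++ positive? (map (_⊖ p) X) (differences X) ⟩
  filter positive? (map (_⊖ p) X) ++ filter positive? (differences X)
    ↭⟨ ↭.++⁺ (↭-reflexive (List.filter-all positive? forward)) (filter-positive-differences X-incr) ⟩
  map (_⊖ p) X ++ forwardDifferences X
    ∎
  where
  open PermutationReasoning
  later-rows : List Point
  later-rows = concatMap (λ q → q ⊖ p ∷ map (q ⊖_) X) X
  later-rows-split : later-rows ↭ map (_⊖ p) X ++ differences X
  later-rows-split = ↭-trans (concatMap-++-↭ (λ q → [ q ⊖ p ]) (λ q → map (q ⊖_) X) X)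
                             (↭-reflexive (cong (_++ differences X) (concatMap-singleton (_⊖ p) X)))
  backward : All (λ d → ¬ Positive d) (p ⊖ p ∷ map (p ⊖_) X)
  backward = ¬positive-⊖-self p ∷ map⁺ (All.map (λ {q} → <ʷ⇒¬positive {p} {q}) p<X)
  forward : All Positive (map (_⊖ p) X)
  forward = map⁺ (All.map (λ {q} → <ʷ⇒positive {p} {q}) p<X)

<ʷ-⊕-step : ∀ p b → p <ʷ p ⊕ step b
<ʷ-⊕-step p b = subst (weight p ℤ.<_) (sym (weight-⊕-step p b)) (ℤ.suc[i]≤j⇒i<j ℤ.≤-refl)

path-step-weight-≥ : ∀ p w → All (λ q → weight p ℤ.≤ weight q) (path step p w)
path-step-weight-≥ p []      = ℤ.≤-refl ∷ []
path-step-weight-≥ p (b ∷ w) =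
  ℤ.≤-refl ∷ All.map (ℤ.≤-trans (ℤ.<⇒≤ (<ʷ-⊕-step p b))) (path-step-weight-≥ (p ⊕ step b) w)

path-step-increasing : ∀ p w → AllPairs _<ʷ_ (path step p w)
path-step-increasing p []      = [] ∷ []
path-step-increasing p (b ∷ w) =
  All.map (ℤ.<-≤-trans (<ʷ-⊕-step p b)) (path-step-weight-≥ (p ⊕ step b) w) ∷ path-step-increasing (p ⊕ step b) w

toComposition : Point → ℕ × ℕ
toComposition (x , y) = (ℤ.∣ x ∣ , ℤ.∣ y ∣)

displacement-counts : ∀ w → displacement w ≡ (ℤ.+ countB false w , ℤ.+ countB true w)
displacement-counts []          = refl
displacement-counts (false ∷ w) rewrite displacement-counts w = refl
displacement-counts (true ∷ w)  rewrite displacement-counts w = refl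

composition-displacement : ∀ w → composition w ≡ toComposition (displacement w)
composition-displacement w rewrite displacement-counts w = refl

displacement-nePrefixes : ∀ b w → map displacement (nePrefixes (b ∷ w)) ≡ path step (step b) w
displacement-nePrefixes b []      = cong [_] (⊕-identityʳ (step b))
displacement-nePrefixes b (c ∷ w) = cong₂ _∷_ (⊕-identityʳ (step b)) (begin
  map displacement (map (b ∷_) (nePrefixes (c ∷ w)))   ≡⟨ List.map-∘ (nePrefixes (c ∷ w)) ⟨
  map (λ u → step b ⊕ displacement u) (nePrefixes (c ∷ w)) ≡⟨ List.map-∘ (nePrefixes (c ∷ w)) ⟩
  map (step b ⊕_) (map displacement (nePrefixes (c ∷ w)))  ≡⟨ cong (map (step b ⊕_)) (displacement-nePrefixes c w) ⟩
  map (step b ⊕_) (path step (step c) w)              ≡⟨ path-translate step (step b) (step c) w ⟨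
  path step (step b ⊕ step c) w                       ∎)
  where open ≡-Reasoning

forwardDifferences-translate : ∀ q X → forwardDifferences (map (q ⊕_) X) ≡ forwardDifferences X
forwardDifferences-translate q []      = refl
forwardDifferences-translate q (p ∷ X) = cong₂ _++_
  (trans (sym (List.map-∘ X)) (List.map-cong (λ r → ⊕-⊖-cancelˡ q r p) X))
  (forwardDifferences-translate q X)

forwardDifferences-origin : ∀ X → forwardDifferences (origin ∷ X) ≡ X ++ forwardDifferences X
forwardDifferences-origin X =
  cong (_++ forwardDifferences X) (trans (List.map-cong ⊖-identityʳ X) (List.map-id X))

compositions-forwardDifferences : ∀ w →
  map composition (substrings w) ≡ map toComposition (forwardDifferences (vertices w))
compositions-forwardDifferences []      = refl
compositions-forwardDifferences (b ∷ w) = begin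
  map composition (nePrefixes (b ∷ w) ++ substrings w)
    ≡⟨ List.map-++ composition (nePrefixes (b ∷ w)) (substrings w) ⟩
  map composition (nePrefixes (b ∷ w)) ++ map composition (substrings w)
    ≡⟨ cong₂ _++_ prefixes (compositions-forwardDifferences w) ⟩
  map toComposition (path step (step b) w) ++ map toComposition (forwardDifferences (vertices w))
    ≡⟨ cong (λ X → map toComposition (path step (step b) w) ++ map toComposition X) shifted ⟩
  map toComposition (path step (step b) w) ++ map toComposition (forwardDifferences (path step (step b) w))
    ≡⟨ List.map-++ toComposition (path step (step b) w) _ ⟨
  map toComposition (path step (step b) w ++ forwardDifferences (path step (step b) w))
    ≡⟨ cong (map toComposition) (forwardDifferences-origin (path step (step b) w)) ⟨
  map toComposition (forwardDifferences (origin ∷ path step (step b) w))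
    ≡⟨ cong (λ p → map toComposition (forwardDifferences (origin ∷ path step p w))) (⊕-identityˡ (step b)) ⟨
  map toComposition (forwardDifferences (vertices (b ∷ w)))
    ∎
  where
  open ≡-Reasoning
  prefixes : map composition (nePrefixes (b ∷ w)) ≡ map toComposition (path step (step b) w)
  prefixes = trans (List.map-cong composition-displacement (nePrefixes (b ∷ w)))
                   (trans (List.map-∘ (nePrefixes (b ∷ w))) (cong (map toComposition) (displacement-nePrefixes b w)))
  shifted : forwardDifferences (vertices w) ≡ forwardDifferences (path step (step b) w)
  shifted = sym (trans (cong forwardDifferences (path-from step (step b) w))
                       (forwardDifferences-translate (step b) (vertices w)))

≋⇒∼ : ∀ {n} {s t : BinString n} → toList s ≋ toList t → s ∼ t
≋⇒∼ {s = s} {t} s≋t = begin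
  map composition (substrings (toList s))                           ≡⟨ compositions-forwardDifferences (toList s) ⟩
  map toComposition (forwardDifferences (vertices (toList s)))      ↭⟨ ↭.map⁺ toComposition forward-↭ ⟩
  map toComposition (forwardDifferences (vertices (toList t)))      ≡⟨ compositions-forwardDifferences (toList t) ⟨
  map composition (substrings (toList t))                           ∎
  where
  open PermutationReasoning
  forward-↭ : forwardDifferences (vertices (toList s)) ↭ forwardDifferences (vertices (toList t))
  forward-↭ = begin
    forwardDifferences (vertices (toList s))              ↭⟨ filter-positive-differences (path-step-increasing origin (toList s)) ⟨
    filter positive? (differences (vertices (toList s)))  ↭⟨ ↭.filter-↭ positive? (_≋_.differences↭ s≋t) ⟩
    filter positive? (differences (vertices (toList t)))  ↭⟨ filter-positive-differences (path-step-increasing origin (toList t)) ⟩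
    forwardDifferences (vertices (toList t))              ∎

-- Families of equicomposable strings

NonPalindrome : List A → Set
NonPalindrome w = ¬ (w ≡ reverse w)

orient : Fin 2 → List Bool → List Bool
orient zero       w = w
orient (suc zero) w = reverse w

length-orient : ∀ i w → length (orient i w) ≡ length w
length-orient zero       w = refl
length-orient (suc zero) w = List.length-reverse w

orient-injective : ∀ {w} → NonPalindrome w → ∀ {i j} → orient i w ≡ orient j w → i ≡ j
orient-injective w≢w̃ {zero}     {zero}     _ = refl
orient-injective w≢w̃ {suc zero} {suc zero} _ = refl
orient-injective w≢w̃ {zero}     {suc zero} e = contradiction e w≢w̃
orient-injective w≢w̃ {suc zero} {zero}     e = contradiction (sym e) w≢w̃

≋-orient-⊛ : ∀ i j w v → orient i w ⊛ v ≋ orient j w ⊛ v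
≋-orient-⊛ zero       zero       w v = ≋-refl
≋-orient-⊛ (suc zero) (suc zero) w v = ≋-refl
≋-orient-⊛ zero       (suc zero) w v = ≋-⊛-reverseˡ w v
≋-orient-⊛ (suc zero) zero       w v =
  ≋-trans (≋-⊛-reverseˡ (reverse w) v) (≋-reflexive (cong (_⊛ v) (List.reverse-involutive w)))

nest : (ws : List (List Bool)) → List Bool → (Fin (length ws) → Fin 2) → List Bool
nest []       base c = base
nest (w ∷ ws) base c = orient (c zero) w ⊛ nest ws base (c ∘ suc)

nest-≋ : ∀ ws base c c' → nest ws base c ≋ nest ws base c'
nest-≋ []       base c c' = ≋-refl
nest-≋ (w ∷ ws) base c c' =
  ≋-trans (≋-⊛ʳ (orient (c zero) w) (nest-≋ ws base (c ∘ suc) (c' ∘ suc))) (≋-orient-⊛ (c zero) (c' zero) w _)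

length-⊛ : ∀ u v → suc (length (u ⊛ v)) ≡ suc (length u) * suc (length v)
length-⊛ []      v = sym (ℕ.*-identityˡ (suc (length v)))
length-⊛ (c ∷ u) v = cong suc (trans (List.length-++ v) (cong (length v +_) (length-⊛ u v)))

length-nest : ∀ ws base c → suc (length (nest ws base c)) ≡ product (map (suc ∘ length) ws) * suc (length base)
length-nest []       base c = sym (ℕ.*-identityˡ (suc (length base)))
length-nest (w ∷ ws) base c = begin
  suc (length (orient (c zero) w ⊛ nest ws base (c ∘ suc)))      ≡⟨ length-⊛ (orient (c zero) w) _ ⟩
  suc (length (orient (c zero) w)) * suc (length (nest ws base (c ∘ suc)))
    ≡⟨ cong₂ (λ l m → suc l * m) (length-orient (c zero) w) (length-nest ws base (c ∘ suc)) ⟩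
  suc (length w) * (product (map (suc ∘ length) ws) * suc (length base))
    ≡⟨ ℕ.*-assoc (suc (length w)) (product (map (suc ∘ length) ws)) (suc (length base)) ⟨
  product (map (suc ∘ length) (w ∷ ws)) * suc (length base)       ∎
  where open ≡-Reasoning

⊛-injective : ∀ u u' {v v'} → length u ≡ length u' → length v ≡ length v' →
  u ⊛ v ≡ u' ⊛ v' → u ≡ u' × v ≡ v'
⊛-injective []      []        _   _   e = refl , e
⊛-injective (c ∷ u) (c' ∷ u') |u| |v| e
  with _ , e' ← ++-injective _ _ |v| e
  with c≡c' , e'' ← List.∷-injective e'
  with u≡u' , v≡v' ← ⊛-injective u u' (ℕ.suc-injective |u|) |v| e''
  = cong₂ _∷_ c≡c' u≡u' , v≡v'

nest-injective : ∀ ws base → All NonPalindrome ws → ∀ c c' → nest ws base c ≡ nest ws base c' → c ≗ c'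
nest-injective []       base _               c c' e ()
nest-injective (w ∷ ws) base (w≢w̃ ∷ nonpal) c c' e = λ where
    zero    → orient-injective w≢w̃ (proj₁ split)
    (suc i) → nest-injective ws base nonpal (c ∘ suc) (c' ∘ suc) (proj₂ split) i
  where
  split : orient (c zero) w ≡ orient (c' zero) w × nest ws base (c ∘ suc) ≡ nest ws base (c' ∘ suc)
  split = ⊛-injective _ _
    (trans (length-orient (c zero) w) (sym (length-orient (c' zero) w)))
    (ℕ.suc-injective (trans (length-nest ws base (c ∘ suc)) (sym (length-nest ws base (c' ∘ suc)))))
    e

MaxEqClassAtLeast-nest : ∀ n ws base → All NonPalindrome ws →
  suc n ≡ product (map (suc ∘ length) ws) * suc (length base) →
  MaxEqClassAtLeast n (2 ^ length ws)
MaxEqClassAtLeast-nest n ws base nonpal n+1≡ =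
  string (λ _ → zero) , string ∘ choice , injective , λ k → ≋⇒∼ (string-≋ (choice k) (λ _ → zero))
  where
  choice : Fin (2 ^ length ws) → Fin (length ws) → Fin 2
  choice = finToFun {2} {length ws}
  length-string : ∀ c → length (nest ws base c) ≡ n
  length-string c = ℕ.suc-injective (trans (length-nest ws base c) (sym n+1≡))
  string : (Fin (length ws) → Fin 2) → BinString n
  string c = fromList≡ (nest ws base c) (length-string c)
  toList-string : ∀ c → toList (string c) ≡ nest ws base c
  toList-string c = toList-fromList≡ (nest ws base c) (length-string c)
  string-≋ : ∀ c c' → toList (string c) ≋ toList (string c')
  string-≋ c c' = ≋-trans (≋-reflexive (toList-string c))
                  (≋-trans (nest-≋ ws base c c') (≋-reflexive (sym (toList-string c'))))
  injective : Injective _≡_ _≡_ (string ∘ choice)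
  injective {k} {k'} e = finToFun-injective (nest-injective ws base nonpal (choice k) (choice k')
    (trans (sym (toList-string (choice k))) (trans (cong toList e) (toList-string (choice k')))))

-- Factorisations of n + 1

gadget : ℕ → List Bool
gadget m = replicate (m ∸ 2) false ∷ʳ true

length-gadget : ∀ {m} → 2 ≤ m → suc (length (gadget m)) ≡ m
length-gadget {suc (suc k)} (s≤s (s≤s _)) = cong suc (begin
  length (replicate k false ++ [ true ])  ≡⟨ List.length-++ (replicate k false) ⟩
  length (replicate k false) + 1          ≡⟨ ℕ.+-comm (length (replicate k false)) 1 ⟩
  suc (length (replicate k false))        ≡⟨ cong suc (List.length-replicate k) ⟩
  suc k                                   ∎)
  where open ≡-Reasoning

gadget-nonPalindrome : ∀ {m} → 3 ≤ m → NonPalindrome (gadget m)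
gadget-nonPalindrome {suc (suc (suc k))} (s≤s (s≤s (s≤s _))) e
  with List.∷-injectiveˡ (trans e (List.reverse-++ (replicate (suc k) false) [ true ]))
... | ()

product-gadgets : ∀ {ms} → All (2 ≤_) ms → product (map (suc ∘ length) (map gadget ms)) ≡ product ms
product-gadgets []             = refl
product-gadgets (2≤m ∷ 2≤ms) = cong₂ _*_ (length-gadget 2≤m) (product-gadgets 2≤ms)

MaxEqClassAtLeast-product : ∀ n ms r → All (3 ≤_) ms → suc n ≡ product ms * suc r → MaxEqClassAtLeast n (2 ^ length ms)
MaxEqClassAtLeast-product n ms r 3≤ms n+1≡ = subst (MaxEqClassAtLeast n ∘ (2 ^_)) (List.length-map gadget ms)
  (MaxEqClassAtLeast-nest n (map gadget ms) (replicate r false) nonPalindromes n+1≡′)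
  where
  nonPalindromes : All NonPalindrome (map gadget ms)
  nonPalindromes = map⁺ (All.map (λ {m} → gadget-nonPalindrome {m}) 3≤ms)
  n+1≡′ : suc n ≡ product (map (suc ∘ length) (map gadget ms)) * suc (length (replicate r false))
  n+1≡′ = trans n+1≡ (cong₂ (λ P l → P * suc l)
    (sym (product-gadgets (All.map ℕ.<⇒≤ 3≤ms))) (sym (List.length-replicate r)))

primePowers : ∀ {k} → Vec ℕ k → Vec ℕ k → List ℕ
primePowers []       []       = []
primePowers (p ∷ ps) (e ∷ es) = replicate e p ++ primePowers ps es

product-replicate : ∀ e m → product (replicate e m) ≡ m ^ e
product-replicate zero    m = refl
product-replicate (suc e) m = cong (m *_) (product-replicate e m)

length-primePowers : ∀ {k} (p e : Vec ℕ k) → length (primePowers p e) ≡ sum e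
length-primePowers []       []       = refl
length-primePowers (p ∷ ps) (e ∷ es) =
  trans (List.length-++ (replicate e p)) (cong₂ _+_ (List.length-replicate e) (length-primePowers ps es))

product-primePowers : ∀ {k} (p e : Vec ℕ k) → product (primePowers p e) ≡ primePowProd p e
product-primePowers []       []       = refl
product-primePowers (p ∷ ps) (e ∷ es) =
  trans (product-++ (replicate e p) _) (cong₂ _*_ (product-replicate e p) (product-primePowers ps es))

oddPrime⇒3≤ : ∀ {p} → Prime p → ¬ (2 ∣ p) → 3 ≤ p
oddPrime⇒3≤ {0}                   p-prime _   = contradiction p-prime ¬prime[0]
oddPrime⇒3≤ {1}                   p-prime _   = contradiction p-prime ¬prime[1]
oddPrime⇒3≤ {2}                   _       2∤2 = contradiction ∣-refl 2∤2
oddPrime⇒3≤ {suc (suc (suc _))}   _       _   = s≤s (s≤s (s≤s z≤n))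

primePowers-≥3 : ∀ {k} (p e : Vec ℕ k) → (∀ i → Prime (lookup p i)) → (∀ i → ¬ (2 ∣ lookup p i)) →
  All (3 ≤_) (primePowers p e)
primePowers-≥3 []       []       _     _   = []
primePowers-≥3 (p ∷ ps) (e ∷ es) prime odd =
  ++⁺ (replicate⁺ e (oddPrime⇒3≤ (prime zero) (odd zero)))
      (primePowers-≥3 ps es (prime ∘ suc) (odd ∘ suc))

4^[m/2]*[1+m%2]≡2^m : ∀ e → 4 ^ (e / 2) * suc (e % 2) ≡ 2 ^ e
4^[m/2]*[1+m%2]≡2^m e = begin
  4 ^ (e / 2) * suc (e % 2)        ≡⟨ cong (4 ^ (e / 2) *_) (suc≡2^ (e % 2) (m%n<n e 2)) ⟩
  4 ^ (e / 2) * 2 ^ (e % 2)        ≡⟨ cong (_* 2 ^ (e % 2)) (ℕ.^-*-assoc 2 2 (e / 2)) ⟩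
  2 ^ (2 * (e / 2)) * 2 ^ (e % 2)  ≡⟨ ℕ.^-distribˡ-+-* 2 (2 * (e / 2)) (e % 2) ⟨
  2 ^ (2 * (e / 2) + e % 2)        ≡⟨ cong (2 ^_) (trans (ℕ.+-comm (2 * (e / 2)) (e % 2)) (cong (e % 2 +_) (ℕ.*-comm 2 (e / 2)))) ⟩
  2 ^ (e % 2 + e / 2 * 2)          ≡⟨ cong (2 ^_) (m≡m%n+[m/n]*n e 2) ⟨
  2 ^ e                            ∎
  where
  open ≡-Reasoning
  suc≡2^ : ∀ r → r < 2 → suc r ≡ 2 ^ r
  suc≡2^ 0 _ = refl
  suc≡2^ 1 _ = refl
  suc≡2^ (suc (suc _)) (s≤s (s≤s ()))

factorList : ∀ {k} → ℕ → Vec ℕ k → Vec ℕ k → List ℕ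
factorList e₀ p e = replicate (e₀ / 2) 4 ++ primePowers p e

length-factorList : ∀ {k} e₀ (p e : Vec ℕ k) → length (factorList e₀ p e) ≡ e₀ / 2 + sum e
length-factorList e₀ p e = trans (List.length-++ (replicate (e₀ / 2) 4))
                                 (cong₂ _+_ (List.length-replicate (e₀ / 2)) (length-primePowers p e))

product-factorList : ∀ {k} e₀ (p e : Vec ℕ k) → 2 ^ e₀ * primePowProd p e ≡ product (factorList e₀ p e) * suc (e₀ % 2)
product-factorList e₀ p e = begin
  2 ^ e₀ * primePowProd p e                        ≡⟨ cong (_* primePowProd p e) (4^[m/2]*[1+m%2]≡2^m e₀) ⟨
  4 ^ (e₀ / 2) * suc (e₀ % 2) * primePowProd p e   ≡⟨ rearrange (4 ^ (e₀ / 2)) (suc (e₀ % 2)) (primePowProd p e) ⟩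
  4 ^ (e₀ / 2) * primePowProd p e * suc (e₀ % 2)
    ≡⟨ cong₂ (λ a b → a * b * suc (e₀ % 2)) (product-replicate (e₀ / 2) 4) (product-primePowers p e) ⟨
  product (replicate (e₀ / 2) 4) * product (primePowers p e) * suc (e₀ % 2)
    ≡⟨ cong (_* suc (e₀ % 2)) (product-++ (replicate (e₀ / 2) 4) (primePowers p e)) ⟨
  product (factorList e₀ p e) * suc (e₀ % 2)       ∎
  where
  open ≡-Reasoning
  rearrange : ∀ a b c → a * b * c ≡ a * c * b
  rearrange = ℕ-Solver.solve-∀

theorem8 : (n : ℕ) → n ≥ 1 → (k e₀ : ℕ) → (p e : Vec ℕ k) →
    (∀ i → Prime (lookup p i)) → (∀ i → ¬ (2 ∣ lookup p i)) → Injective _≡_ _≡_ (lookup p) →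
    suc n ≡ 2 ^ e₀ * primePowProd p e →
    MaxEqClassAtLeast n (2 ^ (e₀ / 2 + sum e))
theorem8 n _ k e₀ p e prime odd _ n+1≡ =
  subst (MaxEqClassAtLeast n ∘ (2 ^_)) (length-factorList e₀ p e)
    (MaxEqClassAtLeast-product n (factorList e₀ p e) (e₀ % 2) factors-≥3 (trans n+1≡ (product-factorList e₀ p e)))
  where
  factors-≥3 : All (3 ≤_) (factorList e₀ p e)
  factors-≥3 = ++⁺ (replicate⁺ (e₀ / 2) (s≤s (s≤s (s≤s z≤n)))) (primePowers-≥3 p e prime odd)
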